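{- Let $\mathcal{A}$ be an S-ring over a finite group $G$ and let $V,W$ be $\mathcal{A}$-subgroups such that $\mathcal{A}=\mathcal{A}_V\star\mathcal{A}_W$ and $V\cap W\trianglelefteq G$. Then $\mathcal{A}$ is the $V/(V\cap W)$-wreath product.
   Context: For $X\subseteq G$, $\underline{X}=\sum_{x\in X}x\in\mathbb{Z}G$. An S-ring over $G$ is a subring $\mathcal{A}$ of $\mathbb{Z}G$ for which there is a partition $\mathcal{S}(\mathcal{A})$ of $G$ (the basic sets) such that $\{1_G\}\in\mathcal{S}(\mathcal{A})$, $X^{ -1}\in\mathcal{S}(\mathcal{A})$ whenever $X\in\mathcal{S}(\mathcal{A})$, and $\mathcal{A}$ is the $\mathbb{Z}$-span of $\{\underline{X}:X\in\mathcal{S}(\mathcal{A})\}$. A subgroup $U\le G$ is an $\mathcal{A}$-subgroup if $\underline{U}\in\mathcal{A}$; $\mathcal{A}_U$ denotes the span of the $\underline X$ with $X\in\mathcal{S}(\mathcal{A})$, $X\subseteq U$. $\mathcal{A}$ is the star product $\mathcal{A}_V\star\mathcal{A}_W$ of $\mathcal{A}$-subgroups $V,W$ if (1) $V\cap W\trianglelefteq W$; (2) every $X\in\mathcal{S}(\mathcal{A})$ with $X\subseteq W\setminus V$ is a union of $(V\cap W)$-cosets; (3) for every $X\in\mathcal{S}(\mathcal{A})$ with $X\subseteq G\setminus(V\cup W)$ there exist $Y,Z\in\mathcal{S}(\mathcal{A})$ with $X=YZ$, $Y\subseteq V$, $Z\subseteq W$. For $\mathcal{A}$-subgroups $L\le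 U$, $\mathcal{A}$ is the $U/L$-wreath product if $L\trianglelefteq G$ and every basic set $X\subseteq G\setminus U$ is a union of $L$-cosets. -}

module Defs where

open import Data.Nat using (ℕ)
open import Data.Fin using (Fin)
open import Data.Fin.Properties using () renaming (_≟_ to _≟ᶠ_)
open import Data.Bool using (Bool; true; false; T)
open import Data.Integer using (ℤ; 0ℤ; 1ℤ; _+_; _*_)
open import Data.List using (List; foldr; map; allFin)
open import Data.Product using (Σ; ∃; ∃-syntax; Σ-syntax; _×_; _,_)
open import Relation.Nullary using (¬_; Dec; yes; no)
open import Relation.Nullary.Decidable using (isYes)
open import Relation.Binary.PropositionalEquality using (_≡_)
open import Function.Bundles using (_⇔_)
open import Algebra.Structures using (IsGroup)

-- A finite group: carrier Fin n (every finite group is isomorphic to one of these),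
-- with propositional equality.
record FinGroup : Set where
  field
    n       : ℕ
    _∙_     : Fin n → Fin n → Fin n
    ε       : Fin n
    _⁻¹     : Fin n → Fin n
    isGroup : IsGroup _≡_ _∙_ ε _⁻¹
  infixl 7 _∙_
  infix 8 _⁻¹

  G : Set
  G = Fin n

  Subset : Set
  Subset = G → Bool

  _∈_ : G → Subset → Set
  g ∈ U = T (U g)

  _∉_ : G → Subset → Set
  g ∉ U = ¬ (g ∈ U)

  _∩_ : Subset → Subset → Subset
  (U ∩ V) g = Data.Bool._∧_ (U g) (V g)

  _⊆_ : Subset → Subset → Set
  U ⊆ V = ∀ g → g ∈ U → g ∈ V

  IsSubgroup : Subset → Set
  IsSubgroup U = (ε ∈ U) × (∀ x y → x ∈ U → y ∈ U → (x ∙ y) ∈ U)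
                 × (∀ x → x ∈ U → (x ⁻¹) ∈ U)

  NormalIn : Subset → Subset → Set
  NormalIn N H = IsSubgroup N × N ⊆ H
                 × (∀ h x → h ∈ H → x ∈ N → ((h ∙ x) ∙ h ⁻¹) ∈ N)

  Normal : Subset → Set
  Normal N = NormalIn N (λ _ → true)

  -- integer group ring ℤG: functions G → ℤ (G is finite)
  ℤG : Set
  ℤG = G → ℤ

  Σℤ : (G → ℤ) → ℤ
  Σℤ f = foldr _+_ 0ℤ (map f (allFin n))

  ind : Bool → ℤ
  ind true  = 1ℤ
  ind false = 0ℤ

  -- underline U = Σ_{x ∈ U} x
  under : Subset → ℤG
  under U g = ind (U g)

  _·_ : ℤG → ℤG → ℤG
  (f · h) z = Σℤ (λ x → f x * h (x ⁻¹ ∙ z))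

  unit : ℤG
  unit g = ind (isYes (g ≟ᶠ ε))

-- Basic sets determined by a class map  cls : G → Fin m  (the partition S(A)
-- consists of the fibres of cls).
module ClassMap (𝔾 : FinGroup) {m : ℕ} (cls : FinGroup.G 𝔾 → Fin m) where
  open FinGroup 𝔾

  Basic : Fin m → Subset
  Basic i g = isYes (cls g ≟ᶠ i)

  IsBasic : (G → Set) → Set
  IsBasic X = ∃[ i ] (∀ g → X g ⇔ (cls g ≡ i))

  Σᵢ : (Fin m → ℤ) → ℤ
  Σᵢ c = foldr _+_ 0ℤ (map c (allFin m))

  -- A = ℤ-span of the underline X, X ∈ S(A)
  InA : ℤG → Set
  InA f = Σ[ c ∈ (Fin m → ℤ) ] (∀ g → f g ≡ Σᵢ (λ i → c i * under (Basic i) g))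

record SRing (𝔾 : FinGroup) : Set where
  open FinGroup 𝔾
  field
    m     : ℕ
    cls   : G → Fin m
    cls-surj : ∀ i → ∃[ g ] cls g ≡ i
    unit-basic : ClassMap.IsBasic 𝔾 cls (λ g → g ≡ ε)
    inv-basic  : ∀ i → ClassMap.IsBasic 𝔾 cls (λ g → (g ⁻¹) ∈ ClassMap.Basic 𝔾 cls i)
    one-closed : ClassMap.InA 𝔾 cls unit
    add-closed : ∀ f h → ClassMap.InA 𝔾 cls f → ClassMap.InA 𝔾 cls h
                 → ClassMap.InA 𝔾 cls (λ g → f g + h g)
    neg-closed : ∀ f → ClassMap.InA 𝔾 cls f → ClassMap.InA 𝔾 cls (λ g → Data.Integer.-_ (f g))
    mul-closed : ∀ f h → ClassMap.InA 𝔾 cls f → ClassMap.InA 𝔾 cls h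
                 → ClassMap.InA 𝔾 cls (f · h)
  open ClassMap 𝔾 cls public

module _ {𝔾 : FinGroup} (𝒜 : SRing 𝔾) where
  open FinGroup 𝔾
  open SRing 𝒜

  IsASubgroup : Subset → Set
  IsASubgroup U = IsSubgroup U × InA (under U)

  UnionOfCosets : Fin m → Subset → Set
  UnionOfCosets i L = ∀ x l → x ∈ Basic i → l ∈ L → (x ∙ l) ∈ Basic i

  IsStarProduct : Subset → Subset → Set
  IsStarProduct V W =
      IsASubgroup V × IsASubgroup W
    × NormalIn (V ∩ W) W
    × (∀ i → Basic i ⊆ W → (∀ g → g ∈ Basic i → g ∉ V) → UnionOfCosets i (V ∩ W))
    × (∀ i → (∀ g → g ∈ Basic i → (g ∉ V) × (g ∉ W)) →
         ∃[ j ] ∃[ k ] (Basic j ⊆ V × Basic k ⊆ W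
           × (∀ g → (g ∈ Basic i) ⇔ (∃[ y ] ∃[ z ] (y ∈ Basic j × z ∈ Basic k × g ≡ y ∙ z)))))

  IsWreathProduct : Subset → Subset → Set
  IsWreathProduct U L =
      IsASubgroup U × IsASubgroup L × L ⊆ U × Normal L
    × (∀ i → (∀ g → g ∈ Basic i → g ∉ U) → UnionOfCosets i L)

-- An A-subgroup is a union of basic sets, so a basic set X outside V lies either in
-- W ∖ V, where the star product makes it a union of (V ∩ W)-cosets, or outside V ∪ W.
-- There X = YZ with Y ⊆ V and Z ⊆ W; Z ⊈ V (otherwise X ⊆ V), so Z ⊆ W ∖ V is a union
-- of (V ∩ W)-cosets, and then so is X = YZ.
module Submission where

open import Defs
open import Data.Nat using (suc)
open import Data.Fin using (Fin; punchIn)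
open import Data.Fin.Properties using (punchInᵢ≢i) renaming (_≟_ to _≟ᶠ_)
open import Data.Bool using (true; false; T; _∧_)
open import Data.Bool.Properties using (T-∧)
open import Data.Integer using (ℤ; 0ℤ; 1ℤ; _+_; _*_)
open import Data.Integer.Properties using (+-0-commutativeMonoid; *-zeroʳ; *-identityʳ; *-identityˡ; +-identityʳ)
open import Data.List using (foldr; tabulate)
open import Data.List.Properties using (map-tabulate)
open import Data.Vec.Functional using (replicate)
open import Data.Product using (∃-syntax; _×_; _,_; proj₁; proj₂)
open import Data.Sum using (_⊎_; inj₁; inj₂)
open import Data.Unit using (tt)
open import Relation.Nullary using (¬_; Dec; contradiction)
open import Relation.Nullary.Decidable using (isYes; isYes≗does; dec-true; dec-false; toWitness; fromWitness)
open import Relation.Binary.PropositionalEquality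
open import Function using (_∘_)
open import Function.Bundles using (_⇔_; Equivalence)
open import Algebra.Structures using (IsGroup)
open import Algebra.Properties.CommutativeMonoid.Sum +-0-commutativeMonoid
  using (sum; sum-remove; sum-cong-≗; sum-replicate-zero)

foldr-tabulate≡sum : ∀ {m} (f : Fin m → ℤ) → foldr _+_ 0ℤ (tabulate f) ≡ sum f
foldr-tabulate≡sum {0}     f = refl
foldr-tabulate≡sum {suc m} f = cong (f Fin.zero +_) (foldr-tabulate≡sum (λ i → f (Fin.suc i)))

sum-supported-at : ∀ {m} (f : Fin m → ℤ) (i : Fin m) →
                   (∀ j → j ≢ i → f j ≡ 0ℤ) → sum f ≡ f i
sum-supported-at {suc m} f i vanish = begin
  sum f                                ≡⟨ sum-remove f ⟩
  f i + sum (λ j → f (punchIn i j))    ≡⟨ cong (f i +_) (sum-cong-≗ (λ j → vanish _ (punchInᵢ≢i i j))) ⟩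
  f i + sum (replicate m 0ℤ)           ≡⟨ cong (f i +_) (sum-replicate-zero m) ⟩
  f i + 0ℤ                             ≡⟨ +-identityʳ (f i) ⟩
  f i                                  ∎
  where open ≡-Reasoning

isYes-true : ∀ {P : Set} (p? : Dec P) → P → isYes p? ≡ true
isYes-true p? p = trans (isYes≗does p?) (dec-true p? p)

isYes-false : ∀ {P : Set} (p? : Dec P) → ¬ P → isYes p? ≡ false
isYes-false p? ¬p = trans (isYes≗does p?) (dec-false p? ¬p)

module _ {𝔾 : FinGroup} where
  open FinGroup 𝔾

  ind-injective : ∀ a b → ind a ≡ ind b → a ≡ b
  ind-injective true  true  _ = refl
  ind-injective false false _ = refl

  ind-∧ : ∀ a b → ind (a ∧ b) ≡ ind a * ind b
  ind-∧ true  b = sym (*-identityˡ (ind b))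
  ind-∧ false b = refl

  module _ (𝒜 : SRing 𝔾) where
    open SRing 𝒜

    span-at : (c : Fin m → ℤ) (g : G) → Σᵢ (λ i → c i * under (Basic i) g) ≡ c (cls g)
    span-at c g = begin
      Σᵢ term                      ≡⟨ cong (foldr _+_ 0ℤ) (map-tabulate (λ i → i) term) ⟩
      foldr _+_ 0ℤ (tabulate term) ≡⟨ foldr-tabulate≡sum term ⟩
      sum term                     ≡⟨ sum-supported-at term (cls g) off-class ⟩
      term (cls g)                 ≡⟨ cong (λ b → c (cls g) * ind b) (isYes-true (cls g ≟ᶠ cls g) refl) ⟩
      c (cls g) * 1ℤ               ≡⟨ *-identityʳ (c (cls g)) ⟩
      c (cls g)                    ∎
      where
      open ≡-Reasoning
      term : Fin m → ℤ
      term i = c i * under (Basic i) g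
      off-class : ∀ i → i ≢ cls g → term i ≡ 0ℤ
      off-class i i≢ = trans (cong (λ b → c i * ind b) (isYes-false (cls g ≟ᶠ i) (i≢ ∘ sym)))
                             (*-zeroʳ (c i))

    InA-class-invariant : ∀ {f} → InA f → ∀ {g h} → cls g ≡ cls h → f g ≡ f h
    InA-class-invariant {f} (c , f≡span) {g} {h} same-class = begin
      f g        ≡⟨ trans (f≡span g) (span-at c g) ⟩
      c (cls g)  ≡⟨ cong c same-class ⟩
      c (cls h)  ≡⟨ trans (f≡span h) (span-at c h) ⟨
      f h        ∎
      where open ≡-Reasoning

    under-constant-on-Basic : ∀ {U i g h} → InA (under U) →
                              g ∈ Basic i → h ∈ Basic i → U g ≡ U h
    under-constant-on-Basic {U} {g = g} {h} U∈A g∈ h∈ = ind-injective (U g) (U h)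
      (InA-class-invariant U∈A (trans (toWitness g∈) (sym (toWitness h∈))))

    Basic-⊆-or-disjoint : ∀ {U} → InA (under U) →
                          ∀ i → Basic i ⊆ U ⊎ (∀ g → g ∈ Basic i → g ∉ U)
    Basic-⊆-or-disjoint {U} U∈A i with g₀ , refl ← cls-surj i = by-representative (U g₀) refl
      where
      same : ∀ {g} → g ∈ Basic (cls g₀) → U g ≡ U g₀
      same g∈ = under-constant-on-Basic U∈A g∈ (fromWitness refl)
      by-representative : ∀ b → U g₀ ≡ b →
                          Basic (cls g₀) ⊆ U ⊎ (∀ g → g ∈ Basic (cls g₀) → g ∉ U)
      by-representative true  U-g₀ = inj₁ λ g g∈ → subst T (sym (trans (same g∈) U-g₀)) tt
      by-representative false U-g₀ = inj₂ λ g g∈ → subst T (trans (same g∈) U-g₀)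

    under-∩-InA : ∀ {V W} → InA (under V) → InA (under W) → InA (under (V ∩ W))
    under-∩-InA {V} {W} (c , V≡span) (d , W≡span) = (λ i → c i * d i) , λ g → begin
      ind (V g ∧ W g)            ≡⟨ ind-∧ (V g) (W g) ⟩
      ind (V g) * ind (W g)      ≡⟨ cong₂ _*_ (trans (V≡span g) (span-at c g))
                                              (trans (W≡span g) (span-at d g)) ⟩
      c (cls g) * d (cls g)      ≡⟨ span-at (λ i → c i * d i) g ⟨
      Σᵢ (λ i → c i * d i * under (Basic i) g) ∎
      where open ≡-Reasoning

    open IsGroup isGroup using (assoc)

    UnionOfCosets-product : ∀ {i j k L} →
      (∀ g → (g ∈ Basic i) ⇔ (∃[ y ] ∃[ z ] (y ∈ Basic j × z ∈ Basic k × g ≡ y ∙ z))) →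
      UnionOfCosets 𝒜 k L → UnionOfCosets 𝒜 i L
    UnionOfCosets-product X≡YZ Z-cosets x l x∈X l∈L
      with y , z , y∈Y , z∈Z , x≡yz ← Equivalence.to (X≡YZ x) x∈X =
      Equivalence.from (X≡YZ (x ∙ l)) (y , z ∙ l , y∈Y , Z-cosets z l z∈Z l∈L , xl≡y[zl])
      where
      xl≡y[zl] : x ∙ l ≡ y ∙ (z ∙ l)
      xl≡y[zl] = trans (cong (_∙ l) x≡yz) (assoc y z l)

    factor-outside : ∀ {V i j k} → IsASubgroup 𝒜 V →
      (∀ g → g ∈ Basic i → g ∉ V) → Basic j ⊆ V →
      (∀ g → (g ∈ Basic i) ⇔ (∃[ y ] ∃[ z ] (y ∈ Basic j × z ∈ Basic k × g ≡ y ∙ z))) →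
      ∀ g → g ∈ Basic k → g ∉ V
    factor-outside {V} {i} {k = k} ((_ , ∙-closed , _) , V∈A) X∩V=∅ Y⊆V X≡YZ
      with Basic-⊆-or-disjoint V∈A k
    ... | inj₂ Z∩V=∅ = Z∩V=∅
    ... | inj₁ Z⊆V with g₀ , cls-g₀ ← cls-surj i
                   with y , z , y∈Y , z∈Z , g₀≡yz ← Equivalence.to (X≡YZ g₀) (fromWitness cls-g₀)
      = contradiction (subst (_∈ V) (sym g₀≡yz) (∙-closed y z (Y⊆V y y∈Y) (Z⊆V z z∈Z)))
                      (X∩V=∅ g₀ (fromWitness cls-g₀))

    star⇒wreath : ∀ {V W} → IsStarProduct 𝒜 V W → Normal (V ∩ W) →
                  IsWreathProduct 𝒜 V (V ∩ W)
    star⇒wreath {V} {W}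
      (V-sub , (_ , W∈A) , (V∩W-sub , _) , W∖V-cosets , outside-factors) V∩W-normal =
      V-sub , (V∩W-sub , under-∩-InA (proj₂ V-sub) W∈A) ,
      (λ g g∈V∩W → proj₁ (Equivalence.to T-∧ g∈V∩W)) , V∩W-normal , outside-V-cosets
      where
      outside-V-cosets : ∀ i → (∀ g → g ∈ Basic i → g ∉ V) → UnionOfCosets 𝒜 i (V ∩ W)
      outside-V-cosets i X∩V=∅ with Basic-⊆-or-disjoint W∈A i
      ... | inj₁ X⊆W = W∖V-cosets i X⊆W X∩V=∅
      ... | inj₂ X∩W=∅
        with j , k , Y⊆V , Z⊆W , X≡YZ ← outside-factors i (λ g g∈ → X∩V=∅ g g∈ , X∩W=∅ g g∈) =
        UnionOfCosets-product X≡YZ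
          (W∖V-cosets k Z⊆W (factor-outside V-sub X∩V=∅ Y⊆V X≡YZ))

lemma2p6 : (𝔾 : FinGroup) (𝒜 : SRing 𝔾) (V W : FinGroup.Subset 𝔾) →
    IsStarProduct 𝒜 V W →
    FinGroup.Normal 𝔾 (FinGroup._∩_ 𝔾 V W) →
    IsWreathProduct 𝒜 V (FinGroup._∩_ 𝔾 V W)
lemma2p6 𝔾 𝒜 V W = star⇒wreath 𝒜
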